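{- Let $m$ be a positive integer and let $k,t$ be integers with $0\le k<2^m$, $1\le t\le 2^m$ and $k+t\le 2^m-1$. Then, over $\mathbb Z_2$: (1) $c_{k+t,t}\equiv \xi_t\cdot A_{k,t}\pmod 2$; (2) $d_{k+t,t}\equiv \xi_t\cdot B_{k,t}+c_{k+t,2^m-t}\pmod 2$.
   Context: For nonnegative integers $i,j$ let $p_{i,j}:=\binom{i+j}{j}\bmod 2$. Define the $t\times t$ matrix $A_{k,t}:=(p_{k+a,b})_{0\le a\le t-1,\ 0\le b\le t-1}$, the $t\times(2^m-t)$ matrix $B_{k,t}:=(p_{k+a,b})_{0\le a\le t-1,\ t\le b\le 2^m-1}$, the row vectors $c_{k+t,t}:=(p_{k+t,0},\dots,p_{k+t,t-1})$, $d_{k+t,t}:=(p_{k+t,t},\dots,p_{k+t,2^m-1})$, $c_{k+t,2^m-t}:=(p_{k+t,0},\dots,p_{k+t,2^m-t-1})$, and $\xi_t:=\left(\binom{t}{0},\binom{t}{1},\dots,\binom{t}{t-1}\right)\bmod 2$ (a row vector of length $t$). -}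

module Defs where

open import Data.Nat using (ℕ; _+_; _*_; _∸_; _^_; _%_)
open import Data.Nat.Combinatorics using (_C_)
open import Data.Fin using (Fin; toℕ)
open import Data.List using (map; allFin)
open import Data.Nat.ListAction using (sum)

p : ℕ → ℕ → ℕ
p i j = ((i + j) C j) % 2

A : ℕ → (t : ℕ) → Fin t → Fin t → ℕ
A k t a b = p (k + toℕ a) (toℕ b)

-- B_{k,t} : t × (2^m - t) matrix, column index j corresponds to b = t + j
B : (m : ℕ) → ℕ → (t : ℕ) → Fin t → Fin (2 ^ m ∸ t) → ℕ
B m k t a j = p (k + toℕ a) (t + toℕ j)


c : ℕ → (n : ℕ) → Fin n → ℕ
c i n b = p i (toℕ b)

-- d_{i,t} = (p i t, ..., p i (2^m - 1)), indexed by j with b = t + j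
d : (m : ℕ) → ℕ → (t : ℕ) → Fin (2 ^ m ∸ t) → ℕ
d m i t j = p i (t + toℕ j)

ξ : (t : ℕ) → Fin t → ℕ
ξ t a = (t C toℕ a) % 2

-- row vector times matrix (over ℕ; reduce mod 2 afterwards)
vecMat : ∀ {r s} → (Fin r → ℕ) → (Fin r → Fin s → ℕ) → Fin s → ℕ
vecMat {r} v M b = sum (map (λ a → v a * M a b) (allFin r))

-- Over GF(2), signs disappear and the rows of the Pascal matrix have generating functions
-- ∑_b binom(i+b, b) x^b = (1+x)^-(i+1).  Hence
--   ∑_{a ≤ t} binom(t,a) (1+x)^-(k+a+1) = (1+x)^-(k+1) (1 + (1+x)^-1)^t = x^t (1+x)^-(k+t+1),
-- whose coefficient of x^b vanishes for b < t and equals binom(k+b, b-t) for b ≥ t.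
-- The term a = t of the left-hand side is row k+t itself; moving it across (in GF(2),
-- subtraction is addition) gives (1) for the columns b < t and (2) for the columns b ≥ t.
-- The identity is proved by induction on t, following binom(t+1,a+1) = binom(t,a) + binom(t,a+1).
module Submission where

open import Defs
open import Data.Nat using (ℕ; zero; suc; _+_; _*_; _∸_; _^_; _%_; _≤_; _<_; z≤n; s≤s)
open import Data.Nat.Properties
  using (+-suc; +-comm; +-assoc; +-identityʳ; *-identityˡ; *-distribʳ-+; *-comm; ≤-refl; m<n⇒m<1+n;
         +-commutativeSemigroup; +-0-commutativeMonoid)
open import Data.Nat.DivMod using (%-distribˡ-+; %-distribˡ-*; m%n%n≡m%n; m*n%n≡0)
open import Data.Nat.Combinatorics using (_C_; nCn≡1; nCk+nC[k+1]≡[n+1]C[k+1]; k>n⇒nCk≡0)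
open import Data.Nat.ListAction using () renaming (sum to sumᴸ)
open import Data.Fin as Fin using (Fin; toℕ; fromℕ; inject₁)
open import Data.Fin.Properties using (toℕ<n; toℕ-fromℕ; toℕ-inject₁)
open import Data.List using (tabulate)
open import Data.List.Properties using (map-tabulate)
open import Data.Product using (_×_; _,_)
open import Function using (_∘_; id)
open import Level using (0ℓ)
open import Relation.Binary.Bundles using (Setoid)
import Relation.Binary.Reasoning.Setoid
open import Relation.Binary.PropositionalEquality
open import Algebra.Properties.CommutativeMonoid.Sum +-0-commutativeMonoid
  using (sum; sum-syntax; ∑-distrib-+; sum-init-last; sum-cong-≗; sum-replicate-zero)
open import Algebra.Properties.CommutativeSemigroup +-commutativeSemigroup using (x∙yz≈y∙xz)

-- A record rather than a synonym for x % 2 ≡ y % 2, so that x and y can be inferred.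
record _≡₂_ (x y : ℕ) : Set where
  constructor mod2
  field %2-≡ : x % 2 ≡ y % 2
open _≡₂_

infix 4 _≡₂_

≡₂-setoid : Setoid 0ℓ 0ℓ
≡₂-setoid = record
  { Carrier = ℕ
  ; _≈_ = _≡₂_
  ; isEquivalence = record
    { refl = mod2 refl
    ; sym = λ (mod2 e) → mod2 (sym e)
    ; trans = λ (mod2 e) (mod2 f) → mod2 (trans e f)
    }
  }

module ≡₂-Reasoning = Relation.Binary.Reasoning.Setoid ≡₂-setoid

≡⇒≡₂ : ∀ {x y} → x ≡ y → x ≡₂ y
≡⇒≡₂ e = mod2 (cong (_% 2) e)

%2≡₂ : ∀ x → x % 2 ≡₂ x
%2≡₂ x = mod2 (m%n%n≡m%n x 2)

+-cong₂ : ∀ {x x′ y y′} → x ≡₂ x′ → y ≡₂ y′ → x + y ≡₂ x′ + y′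
+-cong₂ {x} {x′} {y} {y′} (mod2 e) (mod2 f) = mod2 (begin
  (x + y) % 2              ≡⟨ %-distribˡ-+ x y 2 ⟩
  (x % 2 + y % 2) % 2      ≡⟨ cong₂ (λ u v → (u + v) % 2) e f ⟩
  (x′ % 2 + y′ % 2) % 2    ≡⟨ %-distribˡ-+ x′ y′ 2 ⟨
  (x′ + y′) % 2            ∎)
  where open ≡-Reasoning

*-cong₂ : ∀ {x x′ y y′} → x ≡₂ x′ → y ≡₂ y′ → x * y ≡₂ x′ * y′
*-cong₂ {x} {x′} {y} {y′} (mod2 e) (mod2 f) = mod2 (begin
  (x * y) % 2              ≡⟨ %-distribˡ-* x y 2 ⟩
  (x % 2 * (y % 2)) % 2    ≡⟨ cong₂ (λ u v → (u * v) % 2) e f ⟩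
  (x′ % 2 * (y′ % 2)) % 2  ≡⟨ %-distribˡ-* x′ y′ 2 ⟨
  (x′ * y′) % 2            ∎)
  where open ≡-Reasoning

+-congˡ₂ : ∀ x {y y′} → y ≡₂ y′ → x + y ≡₂ x + y′
+-congˡ₂ x = +-cong₂ {x} {x} (mod2 refl)

+-congʳ₂ : ∀ y {x x′} → x ≡₂ x′ → x + y ≡₂ x′ + y
+-congʳ₂ y x≡₂x′ = +-cong₂ {y = y} {y} x≡₂x′ (mod2 refl)

x+x≡₂0 : ∀ x → x + x ≡₂ 0
x+x≡₂0 x = begin
  x + x  ≡⟨ cong (x +_) (+-identityʳ x) ⟨
  2 * x  ≡⟨ *-comm 2 x ⟩
  x * 2  ≈⟨ mod2 (m*n%n≡0 x 2) ⟩
  0      ∎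
  where open ≡₂-Reasoning

x+y≡₂z⇒y≡₂x+z : ∀ {x y z} → x + y ≡₂ z → y ≡₂ x + z
x+y≡₂z⇒y≡₂x+z {x} {y} {z} x+y≡₂z = begin
  y            ≈⟨ +-congʳ₂ y (x+x≡₂0 x) ⟨
  (x + x) + y  ≡⟨ +-assoc x x y ⟩
  x + (x + y)  ≈⟨ +-congˡ₂ x x+y≡₂z ⟩
  x + z        ∎
  where open ≡₂-Reasoning

pascal : ℕ → ℕ → ℕ
pascal i j = (i + j) C j

pascal-suc-suc : ∀ i j → pascal (suc i) (suc j) ≡ pascal (suc i) j + pascal i (suc j)
pascal-suc-suc i j = begin
  (suc i + suc j) C suc j               ≡⟨ cong (λ n → suc n C suc j) (+-suc i j) ⟩
  suc (suc i + j) C suc j               ≡⟨ nCk+nC[k+1]≡[n+1]C[k+1] (suc i + j) j ⟨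
  (suc i + j) C j + (suc i + j) C suc j ≡⟨ cong (λ n → (suc i + j) C j + n C suc j) (+-suc i j) ⟨
  (suc i + j) C j + (i + suc j) C suc j ∎
  where open ≡-Reasoning

-- Modulo 2, the coefficient of x^b in x^t (1+x)^-(k+t+1).
pascalShift : ℕ → ℕ → ℕ → ℕ
pascalShift k zero    b       = pascal k b
pascalShift k (suc t) zero    = 0
pascalShift k (suc t) (suc b) = pascalShift (suc k) t b

pascalShift-below : ∀ k {t b} → b < t → pascalShift k t b ≡ 0
pascalShift-below k {suc t} {zero}  _           = refl
pascalShift-below k {suc t} {suc b} (s≤s b<t) = pascalShift-below (suc k) b<t

pascalShift-shifted : ∀ k t j → pascalShift k t (t + j) ≡ pascal (k + t) j
pascalShift-shifted k zero    j = cong (λ i → pascal i j) (sym (+-identityʳ k))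
pascalShift-shifted k (suc t) j = trans (pascalShift-shifted (suc k) t j) (cong (λ i → pascal i j) (sym (+-suc k t)))

pascalShift-suc : ∀ k t b → pascalShift k t b + pascalShift (suc k) t b ≡₂ pascalShift k (suc t) b
pascalShift-suc k zero    zero    = x+x≡₂0 1
pascalShift-suc k zero    (suc b) = begin
  x + pascal (suc k) (suc b)  ≡⟨ cong (x +_) (pascal-suc-suc k b) ⟩
  x + (y + x)                 ≡⟨ x∙yz≈y∙xz x y x ⟩
  y + (x + x)                 ≈⟨ +-congˡ₂ y (x+x≡₂0 x) ⟩
  y + 0                       ≡⟨ +-identityʳ y ⟩
  y                           ∎
  where
  open ≡₂-Reasoning
  x = pascal k (suc b)
  y = pascal (suc k) b
pascalShift-suc k (suc t) zero    = mod2 refl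
pascalShift-suc k (suc t) (suc b) = pascalShift-suc (suc k) t b

binomialRowSum : ℕ → ℕ → ℕ → ℕ → ℕ
binomialRowSum n t k b = ∑[ a < n ] ((t C toℕ a) * pascal (k + toℕ a) b)

binomialRowSum-zero : ∀ n k b → binomialRowSum (suc n) 0 k b ≡ pascal k b
binomialRowSum-zero n k b = begin
  1 * pascal (k + 0) b + ∑[ a < n ] ((0 C suc (toℕ a)) * pascal (k + suc (toℕ a)) b)
    ≡⟨ cong₂ _+_ (*-identityˡ (pascal (k + 0) b)) (sum-cong-≗ {y = λ _ → 0} vanish) ⟩
  pascal (k + 0) b + ∑[ a < n ] 0
    ≡⟨ cong₂ _+_ (cong (λ i → pascal i b) (+-identityʳ k)) (sum-replicate-zero n) ⟩
  pascal k b + 0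
    ≡⟨ +-identityʳ (pascal k b) ⟩
  pascal k b ∎
  where
  open ≡-Reasoning
  vanish : ∀ (a : Fin n) → (0 C suc (toℕ a)) * pascal (k + suc (toℕ a)) b ≡ 0
  vanish a = cong (_* pascal (k + suc (toℕ a)) b) (k>n⇒nCk≡0 (s≤s (z≤n {toℕ a})))

binomialRowSum-suc : ∀ n t k b →
  binomialRowSum (suc n) (suc t) k b ≡ binomialRowSum n t (suc k) b + binomialRowSum (suc n) t k b
binomialRowSum-suc n t k b = begin
  x + ∑[ a < n ] ((suc t C suc (toℕ a)) * pascal (k + suc (toℕ a)) b)
                                         ≡⟨ cong (x +_) (sum-cong-≗ pascalRule) ⟩
  x + ∑[ a < n ] (f a + g a)             ≡⟨ cong (x +_) (∑-distrib-+ f g) ⟩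
  x + (∑[ a < n ] f a + ∑[ a < n ] g a)  ≡⟨ x∙yz≈y∙xz x (∑[ a < n ] f a) (∑[ a < n ] g a) ⟩
  ∑[ a < n ] f a + (x + ∑[ a < n ] g a)  ∎
  where
  open ≡-Reasoning
  x = (t C 0) * pascal (k + 0) b
  f g : Fin n → ℕ
  f a = (t C toℕ a) * pascal (suc k + toℕ a) b
  g a = (t C suc (toℕ a)) * pascal (k + suc (toℕ a)) b
  pascalRule : ∀ a → (suc t C suc (toℕ a)) * pascal (k + suc (toℕ a)) b ≡ f a + g a
  pascalRule a = begin
    (suc t C suc i) * pascal (k + suc i) b
      ≡⟨ cong (_* pascal (k + suc i) b) (nCk+nC[k+1]≡[n+1]C[k+1] t i) ⟨
    (t C i + t C suc i) * pascal (k + suc i) b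
      ≡⟨ *-distribʳ-+ (pascal (k + suc i) b) (t C i) (t C suc i) ⟩
    (t C i) * pascal (k + suc i) b + (t C suc i) * pascal (k + suc i) b
      ≡⟨ cong (λ j → (t C i) * pascal j b + g a) (+-suc k i) ⟩
    f a + g a ∎
    where i = toℕ a

-- Allowing any n > t (the terms with a > t vanish) lets both sides of Pascal's rule
-- be summed over the same range.
binomialRowSum≡₂pascalShift : ∀ t n k b → t < n → binomialRowSum n t k b ≡₂ pascalShift k t b
binomialRowSum≡₂pascalShift zero    (suc n) k b _         = ≡⇒≡₂ (binomialRowSum-zero n k b)
binomialRowSum≡₂pascalShift (suc t) (suc n) k b (s≤s t<n) = begin
  binomialRowSum (suc n) (suc t) k b                          ≡⟨ binomialRowSum-suc n t k b ⟩
  binomialRowSum n t (suc k) b + binomialRowSum (suc n) t k b ≈⟨ +-cong₂ (binomialRowSum≡₂pascalShift t n (suc k) b t<n)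
                                                                   (binomialRowSum≡₂pascalShift t (suc n) k b (m<n⇒m<1+n t<n)) ⟩
  pascalShift (suc k) t b + pascalShift k t b                 ≡⟨ +-comm (pascalShift (suc k) t b) (pascalShift k t b) ⟩
  pascalShift k t b + pascalShift (suc k) t b                 ≈⟨ pascalShift-suc k t b ⟩
  pascalShift k (suc t) b                                     ∎
  where open ≡₂-Reasoning

binomialRowSum-last : ∀ t k b → binomialRowSum (suc t) t k b ≡ binomialRowSum t t k b + pascal (k + t) b
binomialRowSum-last t k b = begin
  binomialRowSum (suc t) t k b                   ≡⟨ sum-init-last {t} (term ∘ toℕ) ⟩
  ∑[ a < t ] term (toℕ (inject₁ a)) + term (toℕ (fromℕ t))
    ≡⟨ cong₂ _+_ (sum-cong-≗ {n = t} {y = term ∘ toℕ} (λ a → cong term (toℕ-inject₁ a))) (cong term (toℕ-fromℕ t)) ⟩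
  binomialRowSum t t k b + (t C t) * pascal (k + t) b
    ≡⟨ cong (λ x → binomialRowSum t t k b + x * pascal (k + t) b) (nCn≡1 t) ⟩
  binomialRowSum t t k b + 1 * pascal (k + t) b  ≡⟨ cong (binomialRowSum t t k b +_) (*-identityˡ (pascal (k + t) b)) ⟩
  binomialRowSum t t k b + pascal (k + t) b      ∎
  where
  open ≡-Reasoning
  term : ℕ → ℕ
  term a = (t C a) * pascal (k + a) b

pascal≡₂binomialRowSum+pascalShift : ∀ t k b → pascal (k + t) b ≡₂ binomialRowSum t t k b + pascalShift k t b
pascal≡₂binomialRowSum+pascalShift t k b = x+y≡₂z⇒y≡₂x+z (begin
  binomialRowSum t t k b + pascal (k + t) b ≡⟨ binomialRowSum-last t k b ⟨
  binomialRowSum (suc t) t k b              ≈⟨ binomialRowSum≡₂pascalShift t (suc t) k b ≤-refl ⟩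
  pascalShift k t b                         ∎)
  where open ≡₂-Reasoning

sumᴸ-tabulate : ∀ {n} (f : Fin n → ℕ) → sumᴸ (tabulate f) ≡ sum f
sumᴸ-tabulate {zero}  f = refl
sumᴸ-tabulate {suc n} f = cong (f Fin.zero +_) (sumᴸ-tabulate (f ∘ Fin.suc))

vecMat≡∑ : ∀ {r s} (v : Fin r → ℕ) (M : Fin r → Fin s → ℕ) j → vecMat v M j ≡ ∑[ a < r ] (v a * M a j)
vecMat≡∑ v M j = trans (cong sumᴸ (map-tabulate id (λ a → v a * M a j))) (sumᴸ-tabulate (λ a → v a * M a j))

sum-cong-≡₂ : ∀ {n} {f g : Fin n → ℕ} → (∀ a → f a ≡₂ g a) → sum f ≡₂ sum g
sum-cong-≡₂ {zero}  f≡₂g = mod2 refl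
sum-cong-≡₂ {suc n} f≡₂g = +-cong₂ (f≡₂g Fin.zero) (sum-cong-≡₂ (f≡₂g ∘ Fin.suc))

vecMat-ξ≡₂binomialRowSum : ∀ {s} t k (col : Fin s → ℕ) j →
  vecMat (ξ t) (λ a j → p (k + toℕ a) (col j)) j ≡₂ binomialRowSum t t k (col j)
vecMat-ξ≡₂binomialRowSum t k col j = begin
  vecMat (ξ t) (λ a j → p (k + toℕ a) (col j)) j
    ≡⟨ vecMat≡∑ (ξ t) (λ a j → p (k + toℕ a) (col j)) j ⟩
  ∑[ a < t ] ((t C toℕ a) % 2 * (pascal (k + toℕ a) (col j) % 2))
    ≈⟨ sum-cong-≡₂ {t} (λ a → *-cong₂ (%2≡₂ (t C toℕ a)) (%2≡₂ (pascal (k + toℕ a) (col j)))) ⟩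
  binomialRowSum t t k (col j) ∎
  where open ≡₂-Reasoning

c≡₂ξA : ∀ k t (b : Fin t) → c (k + t) t b ≡₂ vecMat (ξ t) (A k t) b
c≡₂ξA k t b = begin
  c (k + t) t b                                      ≈⟨ %2≡₂ (pascal (k + t) i) ⟩
  pascal (k + t) i                                   ≈⟨ pascal≡₂binomialRowSum+pascalShift t k i ⟩
  binomialRowSum t t k i + pascalShift k t i         ≡⟨ cong (binomialRowSum t t k i +_) (pascalShift-below k (toℕ<n b)) ⟩
  binomialRowSum t t k i + 0                         ≡⟨ +-identityʳ (binomialRowSum t t k i) ⟩
  binomialRowSum t t k i                             ≈⟨ vecMat-ξ≡₂binomialRowSum t k toℕ b ⟨
  vecMat (ξ t) (A k t) b                             ∎
  where
  open ≡₂-Reasoning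
  i = toℕ b

d≡₂ξB+c : ∀ m k t (j : Fin (2 ^ m ∸ t)) →
  d m (k + t) t j ≡₂ vecMat (ξ t) (B m k t) j + c (k + t) (2 ^ m ∸ t) j
d≡₂ξB+c m k t j = begin
  d m (k + t) t j                                    ≈⟨ %2≡₂ (pascal (k + t) (t + i)) ⟩
  pascal (k + t) (t + i)                             ≈⟨ pascal≡₂binomialRowSum+pascalShift t k (t + i) ⟩
  binomialRowSum t t k (t + i) + pascalShift k t (t + i)
    ≡⟨ cong (binomialRowSum t t k (t + i) +_) (pascalShift-shifted k t i) ⟩
  binomialRowSum t t k (t + i) + pascal (k + t) i
    ≈⟨ +-cong₂ (vecMat-ξ≡₂binomialRowSum t k (λ j → t + toℕ j) j) (%2≡₂ (pascal (k + t) i)) ⟨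
  vecMat (ξ t) (B m k t) j + c (k + t) (2 ^ m ∸ t) j ∎
  where
  open ≡₂-Reasoning
  i = toℕ j

lemma6 : (m k t : ℕ) → 1 ≤ m → k < 2 ^ m → 1 ≤ t → t ≤ 2 ^ m → k + t ≤ 2 ^ m ∸ 1 →
         ((b : Fin t) → c (k + t) t b % 2 ≡ vecMat (ξ t) (A k t) b % 2)
         × ((j : Fin (2 ^ m ∸ t)) →
              d m (k + t) t j % 2 ≡ (vecMat (ξ t) (B m k t) j + c (k + t) (2 ^ m ∸ t) j) % 2)
lemma6 m k t _ _ _ _ _ = (λ b → %2-≡ (c≡₂ξA k t b)) , (λ j → %2-≡ (d≡₂ξB+c m k t j))
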